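{- Consider the Fubuki game with prescribed diagonal: one must fill a $3\times 3$ grid with the numbers $1,2,\ldots,9$, each used exactly once, such that the three diagonal entries $s_{1,1},s_{2,2},s_{3,3}$ take prescribed values and each row and each column adds up to a prescribed sum (three given row sums and three given column sums). Let \[ \mathcal{D}:=\big\{\{1,3,4\},\{1,3,6\},\{1,4,6\},\{1,5,7\},\{1,5,8\},\{1,7,8\},\{2,3,4\},\{2,3,5\},\{2,3,6\},\{2,3,8\},\{2,3,9\},\{2,4,6\},\{2,4,7\},\{2,4,8\},\{2,5,6\},\{2,5,9\},\{2,6,7\},\{2,6,8\},\{2,7,8\},\{3,4,6\},\{3,4,8\},\{3,5,6\},\{3,5,7\},\{3,5,9\},\{3,6,8\},\{4,5,7\},\{4,5,8\},\{4,6,7\},\{4,6,8\},\{4,6,9\},\{4,7,8\},\{4,7,9\},\{5,7,8\},\{6,7,8\},\{6,7,9\}\big\}. \] (a) If the set of prescribed diagonal values $\{s_{1,1},s_{2,2},s_{3,3}\}$ belongs to $\mathcal{D}$, then, whatever the prescribed row and column sums, if a solution exists it is unique. (b) If the set of prescribed diagonal values does not belong to $\mathcal{D}$, then, whatever the prescribed row and column sums, there are at most $2$ solutions.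
   Context: A solution is a $3\times 3$ array $(s_{i,j})$ whose nine entries are exactly $1,\ldots,9$ (each once), whose diagonal entries equal the prescribed values, and whose row sums and column sums equal the prescribed sums. -}

module Defs where

open import Data.Nat using (ℕ; _+_)
open import Data.Fin using (Fin; zero; suc)
open import Data.List using (List; []; _∷_)
open import Data.List.Membership.Propositional using (_∈_)
open import Data.List.Relation.Binary.Permutation.Propositional using (_↭_)
open import Data.List.Relation.Unary.Any using (Any)
open import Data.Product using (_×_; Σ)
open import Relation.Binary.PropositionalEquality using (_≡_)
open import Function.Bundles using (_⇔_)

Grid : Set
Grid = Fin 3 → Fin 3 → ℕ

i0 i1 i2 : Fin 3
i0 = zero
i1 = suc zero
i2 = suc (suc zero)

entries : Grid → List ℕ
entries s = s i0 i0 ∷ s i0 i1 ∷ s i0 i2 ∷ s i1 i0 ∷ s i1 i1 ∷ s i1 i2 ∷ s i2 i0 ∷ s i2 i1 ∷ s i2 i2 ∷ []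

oneToNine : List ℕ
oneToNine = 1 ∷ 2 ∷ 3 ∷ 4 ∷ 5 ∷ 6 ∷ 7 ∷ 8 ∷ 9 ∷ []

rowSum : Grid → Fin 3 → ℕ
rowSum s i = s i i0 + s i i1 + s i i2

colSum : Grid → Fin 3 → ℕ
colSum s j = s i0 j + s i1 j + s i2 j

IsSolution : (d r c : Fin 3 → ℕ) → Grid → Set
IsSolution d r c s =
  (entries s ↭ oneToNine) ×
  (∀ i → s i i ≡ d i) ×
  (∀ i → rowSum s i ≡ r i) ×
  (∀ j → colSum s j ≡ c j)

_≋_ : Grid → Grid → Set
s ≋ t = ∀ i j → s i j ≡ t i j

𝒟 : List (List ℕ)
𝒟 =
  (1 ∷ 3 ∷ 4 ∷ []) ∷ (1 ∷ 3 ∷ 6 ∷ []) ∷ (1 ∷ 4 ∷ 6 ∷ []) ∷ (1 ∷ 5 ∷ 7 ∷ []) ∷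
  (1 ∷ 5 ∷ 8 ∷ []) ∷ (1 ∷ 7 ∷ 8 ∷ []) ∷ (2 ∷ 3 ∷ 4 ∷ []) ∷ (2 ∷ 3 ∷ 5 ∷ []) ∷
  (2 ∷ 3 ∷ 6 ∷ []) ∷ (2 ∷ 3 ∷ 8 ∷ []) ∷ (2 ∷ 3 ∷ 9 ∷ []) ∷ (2 ∷ 4 ∷ 6 ∷ []) ∷
  (2 ∷ 4 ∷ 7 ∷ []) ∷ (2 ∷ 4 ∷ 8 ∷ []) ∷ (2 ∷ 5 ∷ 6 ∷ []) ∷ (2 ∷ 5 ∷ 9 ∷ []) ∷
  (2 ∷ 6 ∷ 7 ∷ []) ∷ (2 ∷ 6 ∷ 8 ∷ []) ∷ (2 ∷ 7 ∷ 8 ∷ []) ∷ (3 ∷ 4 ∷ 6 ∷ []) ∷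
  (3 ∷ 4 ∷ 8 ∷ []) ∷ (3 ∷ 5 ∷ 6 ∷ []) ∷ (3 ∷ 5 ∷ 7 ∷ []) ∷ (3 ∷ 5 ∷ 9 ∷ []) ∷
  (3 ∷ 6 ∷ 8 ∷ []) ∷ (4 ∷ 5 ∷ 7 ∷ []) ∷ (4 ∷ 5 ∷ 8 ∷ []) ∷ (4 ∷ 6 ∷ 7 ∷ []) ∷
  (4 ∷ 6 ∷ 8 ∷ []) ∷ (4 ∷ 6 ∷ 9 ∷ []) ∷ (4 ∷ 7 ∷ 8 ∷ []) ∷ (4 ∷ 7 ∷ 9 ∷ []) ∷
  (5 ∷ 7 ∷ 8 ∷ []) ∷ (6 ∷ 7 ∷ 8 ∷ []) ∷ (6 ∷ 7 ∷ 9 ∷ []) ∷ []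

diagList : (Fin 3 → ℕ) → List ℕ
diagList d = d i0 ∷ d i1 ∷ d i2 ∷ []

InD : (Fin 3 → ℕ) → Set
InD d = Any (λ D → ∀ x → (x ∈ diagList d) ⇔ (x ∈ D)) 𝒟

-- Two solutions s, t of the same puzzle agree on the diagonal and have equal
-- row and column sums. Walk around the six off-diagonal cells
-- (0,1) → (0,2) → (1,2) → (1,0) → (2,0) → (2,1), consecutive cells sharing
-- alternately a row and a column: each line sum forces t − s to alternate
-- between +k and −k, where k = t₀₁ − s₀₁. Both grids also put the same six
-- digits, the complement of the diagonal, off the diagonal. Hence, taking s₀₁
-- least, t is determined by s and k, and a nonzero k must move the six
-- off-diagonal digits of s onto themselves. A search through all 60480
-- arrangements of six distinct digits shows that at most one such k exists,
-- and none when the three missing digits form a member of 𝒟.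

module Submission where

open import Defs
open import Data.Bool using (Bool; true; false; T; not)
open import Data.Bool.ListAction using (all)
open import Data.Bool.Properties using (T-≡)
open import Data.Empty using (⊥-elim)
open import Data.Fin using (Fin; zero; suc)
open import Data.List using (List; []; _∷_; _++_; length; filter)
open import Data.List.Membership.Propositional using (_∈_; _∉_)
open import Data.List.Membership.Propositional.Properties
  using (∈-filter⁺; ∈-++⁺ʳ; ∈-++⁻; ∈-applyUpTo⁺; ∈-applyUpTo⁻)
open import Data.List.Relation.Binary.Permutation.Propositional
  using (_↭_; ↭-refl; ↭-sym; ↭-prep; ↭-swap; ↭-trans; ↭⇒↭ₛ; module PermutationReasoning)
open import Data.List.Relation.Binary.Permutation.Propositional.Properties
  using (∈-resp-↭) renaming (shift to ↭-shift)
import Data.List.Relation.Binary.Permutation.Setoid.Properties as Permutationₛ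
open import Data.List.Relation.Binary.Pointwise using ([]; _∷_; Pointwise-≡⇒≡; ≡⇒Pointwise-≡)
open import Data.List.Relation.Unary.All as All using (All; []; _∷_; all?)
open import Data.List.Relation.Unary.All.Properties using (all⁺; ++⁻ʳ; All¬⇒¬Any)
open import Data.List.Relation.Unary.Any as Any using (Any; here; any?)
open import Data.List.Relation.Unary.Unique.Propositional using (Unique; []; _∷_)
open import Data.Nat using (ℕ; zero; suc; _+_; _∸_; _≤_)
open import Data.Nat.Properties
  using (_≟_; ≤-total; ≤-trans; +-assoc; +-comm; +-identityʳ; +-cancelˡ-≡; +-cancelʳ-≡;
         m∸n≤m; m+n∸n≡m; m+[n∸m]≡n)
open import Data.List.Membership.DecPropositional _≟_ using (_∈?_; _∉?_)
open import Data.List.Relation.Unary.Unique.DecPropositional _≟_ using (unique?)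
open import Data.Product using (_×_; _,_; proj₁; proj₂; ∃-syntax)
open import Data.Sum using (_⊎_; inj₁; inj₂; [_,_]′)
open import Function.Base using (_∘_; id)
open import Function.Bundles using (Equivalence)
open import Relation.Binary.PropositionalEquality
  using (_≡_; _≢_; refl; sym; trans; cong; cong₂; subst; setoid; module ≡-Reasoning)
open import Relation.Nullary using (Dec; ¬_; ¬?; yes; no; _×-dec_)
open import Relation.Nullary.Decidable using (isYes; from-yes; fromWitness)

open Equivalence using (to; from)

++-unique⁻ : ∀ {A : Set} (xs : List A) {ys} → Unique (xs ++ ys) → All (_∉ ys) xs × Unique ys
++-unique⁻ []       u              = [] , u
++-unique⁻ (x ∷ xs) (x≢xs++ys ∷ u) with ++-unique⁻ xs u
... | xs∉ys , uys = All¬⇒¬Any (++⁻ʳ xs x≢xs++ys) ∷ xs∉ys , uys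

complement-⊆ : ∀ {A : Set} {xs ys ys′ zs : List A} → Unique zs →
               xs ++ ys ↭ zs → xs ++ ys′ ↭ zs → All (_∈ ys) ys′
complement-⊆ {xs = xs} {ys} {ys′} uzs p p′ = All.tabulate in-ys
  where
  xs∉ys′ : All (_∉ ys′) xs
  xs∉ys′ = proj₁ (++-unique⁻ xs (Permutationₛ.Unique-resp-↭ (setoid _) (↭⇒↭ₛ (↭-sym p′)) uzs))

  in-ys : ∀ {y} → y ∈ ys′ → y ∈ ys
  in-ys y∈ys′ with ∈-++⁻ xs (∈-resp-↭ (↭-sym p) (∈-resp-↭ p′ (∈-++⁺ʳ xs y∈ys′)))
  ... | inj₁ y∈xs = ⊥-elim (All.lookup xs∉ys′ y∈xs y∈ys′)
  ... | inj₂ y∈ys = y∈ys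

↭-diagonal-first : ∀ {A : Set} (a b c d e f g h i : A) →
  a ∷ b ∷ c ∷ d ∷ e ∷ f ∷ g ∷ h ∷ i ∷ [] ↭ a ∷ e ∷ i ∷ b ∷ c ∷ f ∷ d ∷ g ∷ h ∷ []
↭-diagonal-first a b c d e f g h i = ↭-prep a (begin
  b ∷ c ∷ d ∷ e ∷ f ∷ g ∷ h ∷ i ∷ []  ↭⟨ ↭-shift e (b ∷ c ∷ d ∷ []) _ ⟩
  e ∷ b ∷ c ∷ d ∷ f ∷ g ∷ h ∷ i ∷ []  ↭⟨ ↭-prep e (↭-shift i (b ∷ c ∷ d ∷ f ∷ g ∷ h ∷ []) []) ⟩
  e ∷ i ∷ b ∷ c ∷ d ∷ f ∷ g ∷ h ∷ []  ↭⟨ ↭-prep e (↭-prep i (↭-prep b (↭-prep c (↭-swap d f ↭-refl)))) ⟩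
  e ∷ i ∷ b ∷ c ∷ f ∷ d ∷ g ∷ h ∷ []  ∎)
  where open PermutationReasoning

without : ℕ → List ℕ → List ℕ
without x = filter (λ y → ¬? (x ≟ y))

allArrangements : ℕ → List ℕ → (List ℕ → Bool) → Bool
allArrangements zero    xs p = p []
allArrangements (suc n) xs p = all (λ x → allArrangements n (without x xs) (λ ys → p (x ∷ ys))) xs

-- The index n is kept apart from length ys so that a closed instance of the
-- search is used at its own type: unifying it with allArrangements (length ys) …
-- would evaluate the whole search again.
allArrangements-sound : ∀ {n xs ys} (p : List ℕ → Bool) → length ys ≡ n →
                        Unique ys → All (_∈ xs) ys → allArrangements n xs p ≡ true → T (p ys)
allArrangements-sound p refl [] [] holds = from T-≡ holds
allArrangements-sound {xs = xs} {y ∷ ys} p refl (y≢ys ∷ uys) (y∈xs ∷ ys⊆xs) holds =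
  allArrangements-sound (λ zs → p (y ∷ zs)) refl uys ys⊆without
    (to T-≡ (All.lookup (all⁺ _ xs (from T-≡ holds)) y∈xs))
  where
  ys⊆without : All (_∈ without y xs) ys
  ys⊆without = All.zipWith (λ (y≢z , z∈xs) → ∈-filter⁺ (λ z → ¬? (y ≟ z)) z∈xs y≢z) (y≢ys , ys⊆xs)

module _ {A : Set} {P : A → Set} {_∼_ : A → A → Set}
         (∼-sym : ∀ {x y} → x ∼ y → y ∼ x) (key : A → ℕ) where

  wlog-pair : (∀ {x y} → P x → P y → key x ≤ key y → x ∼ y) →
              ∀ {x y} → P x → P y → x ∼ y
  wlog-pair f {x} {y} px py with ≤-total (key x) (key y)
  ... | inj₁ x≤y = f px py x≤y
  ... | inj₂ y≤x = ∼-sym (f py px y≤x)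

  SomePairRelated : A → A → A → Set
  SomePairRelated x y z = x ∼ y ⊎ x ∼ z ⊎ y ∼ z

  private
    swap : ∀ {x y z} → SomePairRelated y x z → SomePairRelated x y z
    swap (inj₁ y∼x)        = inj₁ (∼-sym y∼x)
    swap (inj₂ (inj₁ y∼z)) = inj₂ (inj₂ y∼z)
    swap (inj₂ (inj₂ x∼z)) = inj₂ (inj₁ x∼z)

    rotate : ∀ {x y z} → SomePairRelated z x y → SomePairRelated x y z
    rotate (inj₁ z∼x)        = inj₂ (inj₁ (∼-sym z∼x))
    rotate (inj₂ (inj₁ z∼y)) = inj₂ (inj₂ (∼-sym z∼y))
    rotate (inj₂ (inj₂ x∼y)) = inj₁ x∼y

  module _ (f : ∀ {x y z} → P x → P y → P z → key x ≤ key y → key x ≤ key z → SomePairRelated x y z) where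

    private
      first-of-two-least : ∀ {x y z} → P x → P y → P z → key x ≤ key y → SomePairRelated x y z
      first-of-two-least {x} {z = z} px py pz x≤y with ≤-total (key x) (key z)
      ... | inj₁ x≤z = f px py pz x≤y x≤z
      ... | inj₂ z≤x = rotate (f pz px py z≤x (≤-trans z≤x x≤y))

    wlog-triple : ∀ {x y z} → P x → P y → P z → SomePairRelated x y z
    wlog-triple {x} {y} px py pz with ≤-total (key x) (key y)
    ... | inj₁ x≤y = first-of-two-least px py pz x≤y
    ... | inj₂ y≤x = swap (first-of-two-least py px pz y≤x)

compensate : ∀ {x y x′ y′ k} → x + y ≡ x′ + y′ → x′ ≡ x + k → y ≡ y′ + k
compensate {x} {y} {_} {y′} {k} eq refl = +-cancelˡ-≡ x y (y′ + k) (begin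
  x + y         ≡⟨ eq ⟩
  x + k + y′    ≡⟨ +-assoc x k y′ ⟩
  x + (k + y′)  ≡⟨ cong (x +_) (+-comm k y′) ⟩
  x + (y′ + k)  ∎)
  where open ≡-Reasoning

compensate′ : ∀ {x y x′ y′ k} → x + y ≡ x′ + y′ → y′ ≡ y + k → x ≡ x′ + k
compensate′ {x} {y} {x′} {y′} eq = compensate (trans (+-comm y x) (trans eq (+-comm x′ y′)))

cancel-first : ∀ {a a′ b b′ c c′} → a ≡ a′ → a + b + c ≡ a′ + b′ + c′ → b + c ≡ b′ + c′
cancel-first {a} {_} {b} {b′} {c} {c′} refl eq =
  +-cancelˡ-≡ a (b + c) (b′ + c′) (trans (sym (+-assoc a b c)) (trans eq (+-assoc a b′ c′)))

cancel-middle : ∀ {a a′ b b′ c c′} → b ≡ b′ → a + b + c ≡ a′ + b′ + c′ → a + c ≡ a′ + c′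
cancel-middle {a} {a′} {b} {_} {c} {c′} refl eq = cancel-first {b} {b} {a} {a′} {c} {c′} refl (begin
  b + a + c    ≡⟨ cong (_+ c) (+-comm b a) ⟩
  a + b + c    ≡⟨ eq ⟩
  a′ + b + c′  ≡⟨ cong (_+ c′) (+-comm a′ b) ⟩
  b + a′ + c′  ∎)
  where open ≡-Reasoning

cancel-last : ∀ {x x′ c c′} → c ≡ c′ → x + c ≡ x′ + c′ → x ≡ x′
cancel-last {x} {x′} {c} refl = +-cancelʳ-≡ c x x′

+⇒∸ : ∀ {a b k} → a ≡ b + k → b ≡ a ∸ k
+⇒∸ {b = b} {k} refl = sym (m+n∸n≡m b k)

shift : ℕ → List ℕ → List ℕ
shift k []           = []
shift k (x ∷ [])     = x + k ∷ []
shift k (x ∷ y ∷ zs) = x + k ∷ y ∸ k ∷ shift k zs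

shift-zero : ∀ xs → shift 0 xs ≡ xs
shift-zero []           = refl
shift-zero (x ∷ [])     = cong (_∷ []) (+-identityʳ x)
shift-zero (x ∷ y ∷ zs) = cong₂ _∷_ (+-identityʳ x) (cong (y ∷_) (shift-zero zs))

IsShift : List ℕ → ℕ → Set
IsShift h k = All (_∈ h) (shift k h) × Unique (shift k h)

isShift? : ∀ h k → Dec (IsShift h k)
isShift? h k = all? (_∈? h) (shift k h) ×-dec unique? (shift k h)

-- oneToNine doubles as the range of candidates: a nonzero difference of two digits.
shiftsOf : List ℕ → List ℕ
shiftsOf h = filter (isShift? h) oneToNine

ComplementIn𝒟 : List ℕ → Set
ComplementIn𝒟 h = Any (All (_∉ h)) 𝒟

complementIn𝒟? : ∀ h → Dec (ComplementIn𝒟 h)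
complementIn𝒟? h = any? (all? (_∉? h)) 𝒟

atMostOneᵇ : Bool → List ℕ → Bool
atMostOneᵇ none []          = true
atMostOneᵇ none (_ ∷ [])    = not none
atMostOneᵇ none (_ ∷ _ ∷ _) = false

atMostOneᵇ-≡ : ∀ {none ks k m} → T (atMostOneᵇ none ks) → k ∈ ks → m ∈ ks → k ≡ m
atMostOneᵇ-≡ {ks = _ ∷ []} _ (here refl) (here refl) = refl

atMostOneᵇ-∉ : ∀ {none ks k} → T (atMostOneᵇ none ks) → T none → k ∉ ks
atMostOneᵇ-∉ {ks = []}        _  _  ()
atMostOneᵇ-∉ {true}  {_ ∷ []} () _
atMostOneᵇ-∉ {false} {_ ∷ []} _  ()

shiftBoundᵇ : List ℕ → Bool
shiftBoundᵇ h = atMostOneᵇ (isYes (complementIn𝒟? h)) (shiftsOf h)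

shiftBound-≡ : ∀ h {k m} → T (shiftBoundᵇ h) → k ∈ shiftsOf h → m ∈ shiftsOf h → k ≡ m
shiftBound-≡ h = atMostOneᵇ-≡

shiftBound-∉ : ∀ h {k} → T (shiftBoundᵇ h) → ComplementIn𝒟 h → k ∉ shiftsOf h
shiftBound-∉ h bound complement = atMostOneᵇ-∉ bound (fromWitness complement)

hexagon-check : allArrangements 6 oneToNine shiftBoundᵇ ≡ true
hexagon-check = refl

diagonal : Grid → List ℕ
diagonal s = s i0 i0 ∷ s i1 i1 ∷ s i2 i2 ∷ []

-- In the cyclic order of the hexagon described above.
offDiagonal : Grid → List ℕ
offDiagonal s = s i0 i1 ∷ s i0 i2 ∷ s i1 i2 ∷ s i1 i0 ∷ s i2 i0 ∷ s i2 i1 ∷ []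

entries↭diagonal++offDiagonal : ∀ s → entries s ↭ diagonal s ++ offDiagonal s
entries↭diagonal++offDiagonal s = ↭-diagonal-first
  (s i0 i0) (s i0 i1) (s i0 i2) (s i1 i0) (s i1 i1) (s i1 i2) (s i2 i0) (s i2 i1) (s i2 i2)

≋-sym : ∀ {s t} → s ≋ t → t ≋ s
≋-sym s≋t i j = sym (s≋t i j)

diagonal-offDiagonal-≋ : ∀ {s t} → (∀ i → s i i ≡ t i i) → offDiagonal s ≡ offDiagonal t → s ≋ t
diagonal-offDiagonal-≋ same-diag eq with ≡⇒Pointwise-≡ eq
... | e01 ∷ e02 ∷ e12 ∷ e10 ∷ e20 ∷ e21 ∷ [] = λ where
  zero             zero             → same-diag i0
  zero             (suc zero)       → e01
  zero             (suc (suc zero)) → e02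
  (suc zero)       zero             → e10
  (suc zero)       (suc zero)       → same-diag i1
  (suc zero)       (suc (suc zero)) → e12
  (suc (suc zero)) zero             → e20
  (suc (suc zero)) (suc zero)       → e21
  (suc (suc zero)) (suc (suc zero)) → same-diag i2

offDiagonal-shift : ∀ {s t} → (∀ i → s i i ≡ t i i) →
                    (∀ i → rowSum s i ≡ rowSum t i) → (∀ j → colSum s j ≡ colSum t j) →
                    s i0 i1 ≤ t i0 i1 → offDiagonal t ≡ shift (t i0 i1 ∸ s i0 i1) (offDiagonal s)
offDiagonal-shift {s} {t} same-diag same-rows same-cols s01≤t01 =
  Pointwise-≡⇒≡ (e01 ∷ +⇒∸ e02 ∷ e12 ∷ +⇒∸ e10 ∷ e20 ∷ +⇒∸ e21 ∷ [])
  where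
  k = t i0 i1 ∸ s i0 i1
  row0 : s i0 i1 + s i0 i2 ≡ t i0 i1 + t i0 i2
  row0 = cancel-first (same-diag i0) (same-rows i0)
  col2 : t i0 i2 + t i1 i2 ≡ s i0 i2 + s i1 i2
  col2 = sym (cancel-last (same-diag i2) (same-cols i2))
  row1 : s i1 i0 + s i1 i2 ≡ t i1 i0 + t i1 i2
  row1 = cancel-middle {a = s i1 i0} {t i1 i0} (same-diag i1) (same-rows i1)
  col0 : t i1 i0 + t i2 i0 ≡ s i1 i0 + s i2 i0
  col0 = sym (cancel-first (same-diag i0) (same-cols i0))
  row2 : s i2 i0 + s i2 i1 ≡ t i2 i0 + t i2 i1
  row2 = cancel-last (same-diag i2) (same-rows i2)
  e01 : t i0 i1 ≡ s i0 i1 + k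
  e01 = sym (m+[n∸m]≡n s01≤t01)
  e02 : s i0 i2 ≡ t i0 i2 + k
  e02 = compensate row0 e01
  e12 : t i1 i2 ≡ s i1 i2 + k
  e12 = compensate col2 e02
  e10 : s i1 i0 ≡ t i1 i0 + k
  e10 = compensate′ row1 e12
  e20 : t i2 i0 ≡ s i2 i0 + k
  e20 = compensate col0 e10
  e21 : s i2 i1 ≡ t i2 i1 + k
  e21 = compensate row2 e20

unique-oneToNine : Unique oneToNine
unique-oneToNine = from-yes (unique? oneToNine)

∈-oneToNine⇒≤9 : ∀ {x} → x ∈ oneToNine → x ≤ 9
∈-oneToNine⇒≤9 x∈ with ∈-applyUpTo⁻ suc {n = 9} x∈
... | _ , i<9 , refl = i<9

∈-oneToNine : ∀ {k} → k ≢ 0 → k ≤ 9 → k ∈ oneToNine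
∈-oneToNine {zero}  k≢0 _   = ⊥-elim (k≢0 refl)
∈-oneToNine {suc _} _   k≤9 = ∈-applyUpTo⁺ suc k≤9

module _ {d r c : Fin 3 → ℕ} where

  diagonal≡diagList : ∀ {s} → IsSolution d r c s → diagonal s ≡ diagList d
  diagonal≡diagList (_ , s-diag , _) = Pointwise-≡⇒≡ (s-diag i0 ∷ s-diag i1 ∷ s-diag i2 ∷ [])

  diagList++offDiagonal↭ : ∀ {s} → IsSolution d r c s → diagList d ++ offDiagonal s ↭ oneToNine
  diagList++offDiagonal↭ {s} hs@(entries↭ , _) =
    subst (λ D → D ++ offDiagonal s ↭ oneToNine) (diagonal≡diagList {s} hs)
          (↭-trans (↭-sym (entries↭diagonal++offDiagonal s)) entries↭)

  diagList++offDiagonal-unique : ∀ {s} → IsSolution d r c s → Unique (diagList d ++ offDiagonal s)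
  diagList++offDiagonal-unique {s} hs =
    Permutationₛ.Unique-resp-↭ (setoid ℕ) (↭⇒↭ₛ (↭-sym (diagList++offDiagonal↭ {s} hs))) unique-oneToNine

  diagList∉offDiagonal : ∀ {s} → IsSolution d r c s → All (_∉ offDiagonal s) (diagList d)
  diagList∉offDiagonal {s} hs = proj₁ (++-unique⁻ (diagList d) (diagList++offDiagonal-unique {s} hs))

  offDiagonal-unique : ∀ {s} → IsSolution d r c s → Unique (offDiagonal s)
  offDiagonal-unique {s} hs = proj₂ (++-unique⁻ (diagList d) (diagList++offDiagonal-unique {s} hs))

  offDiagonal⊆oneToNine : ∀ {s} → IsSolution d r c s → All (_∈ oneToNine) (offDiagonal s)
  offDiagonal⊆oneToNine {s} hs =
    All.tabulate (∈-resp-↭ (diagList++offDiagonal↭ {s} hs) ∘ ∈-++⁺ʳ (diagList d))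

  InD⇒ComplementIn𝒟 : ∀ {s} → IsSolution d r c s → InD d → ComplementIn𝒟 (offDiagonal s)
  InD⇒ComplementIn𝒟 {s} hs = Any.map λ D≈diagList → All.tabulate λ x∈D →
    All.lookup (diagList∉offDiagonal {s} hs) (from (D≈diagList _) x∈D)

  shiftBound : ∀ {s} → IsSolution d r c s → T (shiftBoundᵇ (offDiagonal s))
  shiftBound {s} hs = allArrangements-sound {n = 6} {xs = oneToNine} shiftBoundᵇ refl
    (offDiagonal-unique {s} hs) (offDiagonal⊆oneToNine {s} hs) hexagon-check

  same-diag : ∀ {s t} → IsSolution d r c s → IsSolution d r c t → ∀ i → s i i ≡ t i i
  same-diag (_ , s-diag , _) (_ , t-diag , _) i = trans (s-diag i) (sym (t-diag i))

  same-rows : ∀ {s t} → IsSolution d r c s → IsSolution d r c t → ∀ i → rowSum s i ≡ rowSum t i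
  same-rows (_ , _ , s-rows , _) (_ , _ , t-rows , _) i = trans (s-rows i) (sym (t-rows i))

  same-cols : ∀ {s t} → IsSolution d r c s → IsSolution d r c t → ∀ j → colSum s j ≡ colSum t j
  same-cols (_ , _ , _ , s-cols) (_ , _ , _ , t-cols) j = trans (s-cols j) (sym (t-cols j))

  Shifted : Grid → Grid → Set
  Shifted s t = ∃[ k ] k ∈ shiftsOf (offDiagonal s) × offDiagonal t ≡ shift k (offDiagonal s)

  module _ {s t : Grid} (hs : IsSolution d r c s) (ht : IsSolution d r c t) where

    solutions-shift : s i0 i1 ≤ t i0 i1 → s ≋ t ⊎ Shifted s t
    solutions-shift s01≤t01 = by-cases (t i0 i1 ∸ s i0 i1 ≟ 0)
      where
      shifted : offDiagonal t ≡ shift (t i0 i1 ∸ s i0 i1) (offDiagonal s)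
      shifted = offDiagonal-shift {s} {t} (same-diag {s} {t} hs ht) (same-rows {s} {t} hs ht)
                                  (same-cols {s} {t} hs ht) s01≤t01

      t01≤9 : t i0 i1 ≤ 9
      t01≤9 = ∈-oneToNine⇒≤9 (All.lookup (offDiagonal⊆oneToNine {t} ht) (here refl))

      isShift : IsShift (offDiagonal s) (t i0 i1 ∸ s i0 i1)
      isShift = subst (λ ys → All (_∈ offDiagonal s) ys × Unique ys) shifted
        ( complement-⊆ {xs = diagList d} unique-oneToNine (diagList++offDiagonal↭ {s} hs) (diagList++offDiagonal↭ {t} ht)
        , offDiagonal-unique {t} ht)

      by-cases : Dec (t i0 i1 ∸ s i0 i1 ≡ 0) → s ≋ t ⊎ Shifted s t
      by-cases (yes k≡0) = inj₁ (diagonal-offDiagonal-≋ (same-diag {s} {t} hs ht) (sym (begin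
        offDiagonal t                              ≡⟨ shifted ⟩
        shift (t i0 i1 ∸ s i0 i1) (offDiagonal s)  ≡⟨ cong (λ k → shift k (offDiagonal s)) k≡0 ⟩
        shift 0 (offDiagonal s)                    ≡⟨ shift-zero (offDiagonal s) ⟩
        offDiagonal s                              ∎)))
        where open ≡-Reasoning
      by-cases (no k≢0) = inj₂ (_ , ∈-filter⁺ (isShift? (offDiagonal s)) k∈oneToNine isShift , shifted)
        where
        k∈oneToNine : t i0 i1 ∸ s i0 i1 ∈ oneToNine
        k∈oneToNine = ∈-oneToNine k≢0 (≤-trans (m∸n≤m (t i0 i1) (s i0 i1)) t01≤9)

    ordered-unique : InD d → s i0 i1 ≤ t i0 i1 → s ≋ t
    ordered-unique ind s01≤t01 = [ id , no-shift ]′ (solutions-shift s01≤t01)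
      where
      no-shift : Shifted s t → s ≋ t
      no-shift (_ , k∈shifts , _) =
        ⊥-elim (shiftBound-∉ (offDiagonal s) (shiftBound {s} hs) (InD⇒ComplementIn𝒟 {s} hs ind) k∈shifts)

  shifts-≋ : ∀ {s t u} → IsSolution d r c s → IsSolution d r c t → IsSolution d r c u →
             Shifted s t → Shifted s u → t ≋ u
  shifts-≋ {s} {t} {u} hs ht hu (k , k∈shifts , t≡) (m , m∈shifts , u≡) =
    diagonal-offDiagonal-≋ (same-diag {t} {u} ht hu) (begin
      offDiagonal t            ≡⟨ t≡ ⟩
      shift k (offDiagonal s)  ≡⟨ cong (λ k → shift k (offDiagonal s)) k≡m ⟩
      shift m (offDiagonal s)  ≡⟨ sym u≡ ⟩
      offDiagonal u            ∎)
    where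
    open ≡-Reasoning
    k≡m = shiftBound-≡ (offDiagonal s) (shiftBound {s} hs) k∈shifts m∈shifts

  ordered-two-of-three : ∀ {s t u} → IsSolution d r c s → IsSolution d r c t → IsSolution d r c u →
                         s i0 i1 ≤ t i0 i1 → s i0 i1 ≤ u i0 i1 → s ≋ t ⊎ s ≋ u ⊎ t ≋ u
  ordered-two-of-three {s} {t} {u} hs ht hu s01≤t01 s01≤u01 =
    combine (solutions-shift {s} {t} hs ht s01≤t01) (solutions-shift {s} {u} hs hu s01≤u01)
    where
    combine : s ≋ t ⊎ Shifted s t → s ≋ u ⊎ Shifted s u → s ≋ t ⊎ s ≋ u ⊎ t ≋ u
    combine (inj₁ s≋t)       _                = inj₁ s≋t
    combine (inj₂ _)         (inj₁ s≋u)       = inj₂ (inj₁ s≋u)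
    combine (inj₂ t-shifted) (inj₂ u-shifted) = inj₂ (inj₂ (shifts-≋ {s} {t} {u} hs ht hu t-shifted u-shifted))

topMiddle : Grid → ℕ
topMiddle s = s i0 i1

-- Part (b) holds for every diagonal.
theorem1p1 : ((d r c : Fin 3 → ℕ) → InD d → ∀ s t →
                IsSolution d r c s → IsSolution d r c t → s ≋ t)
             × ((d r c : Fin 3 → ℕ) → ¬ InD d → ∀ s t u →
                IsSolution d r c s → IsSolution d r c t → IsSolution d r c u →
                (s ≋ t) ⊎ (s ≋ u) ⊎ (t ≋ u))
theorem1p1 =
    (λ d r c ind s t → wlog-pair {P = IsSolution d r c} ≋-sym topMiddle
       (λ {s} {t} hs ht → ordered-unique {s = s} {t} hs ht ind) {s} {t})
  , (λ d r c _ s t u → wlog-triple {P = IsSolution d r c} ≋-sym topMiddle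
       (λ {s} {t} {u} hs ht hu → ordered-two-of-three {s = s} {t} {u} hs ht hu) {s} {t} {u})
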